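{- Let $\mathcal{A}$ be a deterministic parity automaton over $\{0,1\}^3$. (1) There is a monadic second-order formula $\mathit{winSt}^I(X)$ over the signature $\tau_{\mathcal{A}}$ such that for every $\mathbf{P}\subseteq\mathbb{N}$ and every set $U$ of nodes, $M_{\mathcal{A},\mathbf{P}}\models\mathit{winSt}^I(U)$ iff $U$ corresponds to a memoryless winning strategy for Player I in $G_{\mathcal{A},\mathbf{P}}$ (i.e. $U\subseteq V_1$ and $f_U$ is winning for Player I). (2) There is a monadic second-order formula $\mathit{winSt}^{II}(X)$ such that $M_{\mathcal{A},\mathbf{P}}\models\mathit{winSt}^{II}(U)$ iff $U$ corresponds to a memoryless winning strategy for Player II (i.e. $U\subseteq V_2$ and $f_U$ is winning for Player II). (3) Moreover, $\mathit{winSt}^I$ and $\mathit{winSt}^{II}$ are computable from $\mathcal{A}$.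
   Context: A deterministic parity automaton $\mathcal{A}=\langle Q,\Sigma,\delta,q_{init},col\rangle$ has finite state set $Q$, $\delta:Q\times\Sigma\to Q$, $q_{init}\in Q$, $col:Q\to\mathbb{N}$. Game $G_{\mathcal{A},\mathbf{P}}$ ($\mathbf{P}\subseteq\mathbb{N}$): $V_1=Q\times\mathbb{N}$ (Player I nodes), $V_2=Q\times\{0,1\}\times\mathbb{N}$ (Player II nodes). From $\langle q,n\rangle$ there is an edge labelled $0$ to $\langle q,0,n\rangle$ and one labelled $1$ to $\langle q,1,n\rangle$. From $\langle q,a,n\rangle$, with $c=1$ if $n\in\mathbf{P}$ and $c=0$ otherwise, there is an edge labelled $b$ to $\langle\delta(q,\langle a,b,c\rangle),n+1\rangle$ for $b\in\{0,1\}$. Colours: $\langle q,n\rangle$ and $\langle q,a,n\rangle$ have colour $col(q)$. Plays start at $\langle q_{init},0\rangle$, the owner of the current node choosing the next edge; Player I wins a play iff the minimal colour occurring infinitely often is odd, else Player II wins. For $U\subseteq V_1$ (resp. $V_2$) the memoryless strategy $f_U$ of Player I (resp. II) takes, at each of its nodes $v$, the edge labelled $1$ iff $v\in U$; it is winning if every play consistent with it is won by its owner. The structure $M_{\mathcal{A},\mathbf{P}}$ has universe $V_1\cup V_2$ and signature $\tau_{\mathcal{A}}=\{R_i: i\in Q\cup Q\times\{0,1\}\}\cup\{\mathit{Init},P,\prec,E_0,E_1\}$ interpreted by: $R_q=\{\langle q,j\rangle:j\in\mathbb{N}\}$, $R_{\langle q,a\rangle}=\{\langle q,a,j\rangle:j\in\mathbb{N}\}$;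 $P=\{\langle q,m\rangle: m\in\mathbf{P}\}\cup\{\langle q,a,m\rangle:m\in\mathbf{P}\}$; $\mathit{Init}=\{\langle q_{init},0\rangle\}$; $E_b(v_1,v_2)$ iff there is an edge labelled $b$ from $v_1$ to $v_2$; $v_1\prec v_2$ iff the $\mathbb{N}$-coordinate (last coordinate) of $v_1$ is smaller than that of $v_2$. Monadic second-order formulas have set variables ranging over sets of nodes. -}

module Defs where

open import Data.Nat using (ℕ; zero; suc; _<_; _≤_)
open import Data.Nat.Base using (_%_)
open import Data.Fin using (Fin)
open import Data.Bool using (Bool; true; false)
open import Data.Sum using (_⊎_; inj₁; inj₂)
open import Data.Product using (Σ; _×_; _,_; ∃)
open import Data.Empty using (⊥)
open import Data.Unit using (⊤)
open import Relation.Nullary using (¬_)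
open import Relation.Binary.PropositionalEquality using (_≡_)

-- Deterministic parity automata over the alphabet {0,1}^3.
-- States Q = Fin nQ; bits 0/1 are false/true; a letter ⟨a,b,c⟩ is
-- given as three curried Bool arguments.

record DPA : Set where
  field
    nQ    : ℕ
    δ     : Fin nQ → Bool → Bool → Bool → Fin nQ
    qinit : Fin nQ
    col   : Fin nQ → ℕ

data Node (k : ℕ) : Set where
  v₁ : Fin k → ℕ → Node k
  v₂ : Fin k → Bool → ℕ → Node k

level : ∀ {k} → Node k → ℕ
level (v₁ q n)   = n
level (v₂ q a n) = n

IsV₁ : ∀ {k} → Node k → Set
IsV₁ (v₁ _ _)   = ⊤
IsV₁ (v₂ _ _ _) = ⊥

IsV₂ : ∀ {k} → Node k → Set
IsV₂ (v₁ _ _)   = ⊥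
IsV₂ (v₂ _ _ _) = ⊤

SubsetℕP : Set
SubsetℕP = ℕ → Bool

NodeSet : ℕ → Set
NodeSet k = Node k → Bool

_∈ₙ_ : ∀ {k} → Node k → NodeSet k → Set
v ∈ₙ U = U v ≡ true

module _ (A : DPA) (P : SubsetℕP) where
  open DPA A

  step : Node nQ → Bool → Node nQ
  step (v₁ q n)   b = v₂ q b n
  step (v₂ q a n) b = v₁ (δ q a b (P n)) (suc n)

  Edge : Bool → Node nQ → Node nQ → Set
  Edge b v w = step v b ≡ w

  colour : Node nQ → ℕ
  colour (v₁ q _)   = col q
  colour (v₂ q _ _) = col q

  initNode : Node nQ
  initNode = v₁ qinit 0

  Play : Set
  Play = ℕ → Node nQ

  InfOften : Play → ℕ → Set
  InfOften π c = ∀ i → Σ ℕ λ j → (i ≤ j) × (colour (π j) ≡ c)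

  Odd : ℕ → Set
  Odd c = c % 2 ≡ 1

  WonByI : Play → Set
  WonByI π = Σ ℕ λ c → InfOften π c × (∀ c' → c' < c → ¬ InfOften π c') × Odd c

  WonByII : Play → Set
  WonByII π = ¬ WonByI π

  -- plays consistent with the memoryless strategy f_U of Player I:
  -- at V₁-nodes the edge labelled 1 (true) is taken iff the node is in U,
  -- at V₂-nodes any edge may be taken.
  ConsistentI : NodeSet nQ → Play → Set
  ConsistentI U π = (π 0 ≡ initNode) ×
    (∀ i → Σ Bool λ b → Edge b (π i) (π (suc i)) × (IsV₁ (π i) → b ≡ U (π i)))

  ConsistentII : NodeSet nQ → Play → Set
  ConsistentII U π = (π 0 ≡ initNode) ×
    (∀ i → Σ Bool λ b → Edge b (π i) (π (suc i)) × (IsV₂ (π i) → b ≡ U (π i)))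

  WinStratI : NodeSet nQ → Set
  WinStratI U = (∀ v → v ∈ₙ U → IsV₁ v) × (∀ π → ConsistentI U π → WonByI π)

  WinStratII : NodeSet nQ → Set
  WinStratII U = (∀ v → v ∈ₙ U → IsV₂ v) × (∀ π → ConsistentII U π → WonByII π)

-- Monadic second-order logic over τ_A (k = |Q|), with well-scoped
-- de Bruijn indices: fo first-order and so set variables in scope.

data Formula (k : ℕ) (fo so : ℕ) : Set where
  Rel   : (Fin k ⊎ (Fin k × Bool)) → Fin fo → Formula k fo so
  Init  : Fin fo → Formula k fo so
  Pr    : Fin fo → Formula k fo so
  Prec  : Fin fo → Fin fo → Formula k fo so
  E     : Bool → Fin fo → Fin fo → Formula k fo so
  Eq    : Fin fo → Fin fo → Formula k fo so
  Mem   : Fin fo → Fin so → Formula k fo so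
  Not   : Formula k fo so → Formula k fo so
  And   : Formula k fo so → Formula k fo so → Formula k fo so
  Ex₁   : Formula k (suc fo) so → Formula k fo so
  Ex₂   : Formula k fo (suc so) → Formula k fo so

module _ (A : DPA) (P : SubsetℕP) where
  open DPA A

  relInterp : (Fin nQ ⊎ (Fin nQ × Bool)) → Node nQ → Set
  relInterp (inj₁ q)       (v₁ q' _)    = q ≡ q'
  relInterp (inj₁ q)       (v₂ _ _ _)   = ⊥
  relInterp (inj₂ (q , a)) (v₁ _ _)     = ⊥
  relInterp (inj₂ (q , a)) (v₂ q' a' _) = (q ≡ q') × (a ≡ a')

  _∷ᶠ_ : ∀ {m} {B : Set} → B → (Fin m → B) → Fin (suc m) → B
  (x ∷ᶠ ρ) Fin.zero    = x
  (x ∷ᶠ ρ) (Fin.suc i) = ρ i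

  Sat : ∀ {fo so} → (Fin fo → Node nQ) → (Fin so → NodeSet nQ)
      → Formula nQ fo so → Set
  Sat ρ σ (Rel i x)  = relInterp i (ρ x)
  Sat ρ σ (Init x)   = ρ x ≡ initNode A P
  Sat ρ σ (Pr x)     = P (level (ρ x)) ≡ true
  Sat ρ σ (Prec x y) = level (ρ x) < level (ρ y)
  Sat ρ σ (E b x y)  = Edge A P b (ρ x) (ρ y)
  Sat ρ σ (Eq x y)   = ρ x ≡ ρ y
  Sat ρ σ (Mem x X)  = ρ x ∈ₙ σ X
  Sat ρ σ (Not φ)    = ¬ Sat ρ σ φ
  Sat ρ σ (And φ ψ)  = Sat ρ σ φ × Sat ρ σ ψ
  Sat ρ σ (Ex₁ φ)    = Σ (Node nQ) λ v → Sat (v ∷ᶠ ρ) σ φ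
  Sat ρ σ (Ex₂ φ)    = Σ (NodeSet nQ) λ V → Sat ρ (V ∷ᶠ σ) φ

  Models₁ : Formula nQ 0 1 → NodeSet nQ → Set
  Models₁ φ U = Sat (λ ()) (λ _ → U) φ

-- A memoryless strategy f_U of player p is winning iff every play
-- consistent with it is won by p, and such a play can be replaced by its set
-- of nodes Y. A set Y is the node set of a play consistent with f_U iff it
-- contains the initial node, every node of Y has a successor in Y along an
-- edge allowed by f_U, and Y meets every "slot" (a level together with an
-- owner) at most once: a play visits the slots one by one in order, so these
-- conditions leave no room for a second play. On such a Y, "colour c occurs
-- infinitely often" reads "every level is exceeded by a node of Y of colour c",
-- so p's winning condition is first-order in Y, and
--   winSt^p(X) := X ⊆ V_p ∧ ∀Y (Y is such a node set → p wins on Y).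
-- Both formulas are defined by recursion on the automaton, hence computable.

module Submission where

open import Defs
open import Data.Product using (Σ; _×_; _,_; proj₁; proj₂; ∃)
open import Data.Nat using (ℕ; zero; suc; _+_; _<_; _≤_; _%_; _≟_; ⌊_/2⌋)
open import Data.Nat.Properties
  using (n≡⌊n+n/2⌋; n≡⌈n+n/2⌉; ⌊n/2⌋-mono; ⌊n/2⌋≤n; even≢odd; +-suc; +-identityʳ
        ; ≤-antisym; <-irrefl; module ≤-Reasoning; ≮⇒≥; <⇒≤; ≤-trans; ≤-refl; m≤n⇒m≤1+n; m<1+n⇒m<n∨m≡n)
open import Data.Fin using (Fin; #_)
open import Data.Bool using (Bool; true; false)
open import Data.Sum using (_⊎_; inj₁; inj₂)
open import Data.Empty using (⊥-elim)
open import Data.Unit using (tt)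
open import Level using (0ℓ)
open import Function using (_∘_)
open import Function.Bundles using (_⇔_; mk⇔; Equivalence)
open import Function.Properties.Equivalence using () renaming (refl to ⇔-refl; sym to ⇔-sym; trans to ⇔-trans)
open import Data.Sum.Function.Propositional using (_⊎-⇔_)
open import Axiom.ExcludedMiddle using (ExcludedMiddle)
open import Axiom.DoubleNegationElimination using (em⇒dne)
open import Relation.Nullary using (¬_; Dec; yes; no; does)
open import Relation.Binary.PropositionalEquality using (_≡_; _≢_; refl; sym; trans; cong; subst; subst₂; module ≡-Reasoning)
open import Function.Related.TypeIsomorphisms using (¬-cong-⇔; →-cong-⇔)
open import Data.Product.Function.NonDependent.Propositional using (_×-⇔_)

open Equivalence using (to; from)

private
  variable
    k fo so n : ℕ

∀-cong-⇔ : {X : Set} {F G : X → Set} → (∀ x → F x ⇔ G x) → (∀ x → F x) ⇔ (∀ x → G x)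
∀-cong-⇔ F⇔G = mk⇔ (λ f x → to (F⇔G x) (f x)) (λ g x → from (F⇔G x) (g x))

∃-cong-⇔ : {X : Set} {F G : X → Set} → (∀ x → F x ⇔ G x) → (∃ F) ⇔ (∃ G)
∃-cong-⇔ F⇔G = mk⇔ (λ (x , Fx) → x , to (F⇔G x) Fx) (λ (x , Gx) → x , from (F⇔G x) Gx)

∃-target⇔∃-label : {N : Set} {Z : N → Set} {C : Bool → Set} (f : Bool → N) →
  (∃ λ w → Z w × ((f false ≡ w × C false) ⊎ (f true ≡ w × C true))) ⇔ (∃ λ b → Z (f b) × C b)
∃-target⇔∃-label f = mk⇔
  (λ { (_ , Zw , inj₁ (refl , c)) → false , Zw , c ; (_ , Zw , inj₂ (refl , c)) → true , Zw , c })
  (λ { (false , Zw , c) → f false , Zw , inj₁ (refl , c) ; (true , Zw , c) → f true , Zw , inj₂ (refl , c) })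

module Classical (em : ExcludedMiddle 0ℓ) where

  private
    variable
      A B : Set

  dne : ¬ ¬ A → A
  dne = em⇒dne em

  ¬[¬×¬]⇔⊎ : (¬ (¬ A × ¬ B)) ⇔ (A ⊎ B)
  ¬[¬×¬]⇔⊎ {A} = mk⇔ to′ λ { (inj₁ a) (¬a , _) → ¬a a ; (inj₂ b) (_ , ¬b) → ¬b b }
    where
    to′ : ¬ (¬ A × ¬ B) → A ⊎ B
    to′ h with em {A}
    ... | yes a = inj₁ a
    ... | no ¬a = inj₂ (dne λ ¬b → h (¬a , ¬b))

  ¬[×¬]⇔→ : (¬ (A × ¬ B)) ⇔ (A → B)
  ¬[×¬]⇔→ = mk⇔ (λ h a → dne λ ¬b → h (a , ¬b)) λ f (a , ¬b) → ¬b (f a)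

  ¬∃¬⇔∀ : {P : A → Set} → (¬ ∃ λ x → ¬ P x) ⇔ (∀ x → P x)
  ¬∃¬⇔∀ = mk⇔ (λ h x → dne λ ¬p → h (x , ¬p)) λ f (x , ¬p) → ¬p (f x)

  decideSet : (Node k → Set) → NodeSet k
  decideSet X v = does (em {X v})

  ∈-decideSet : {X : Node k → Set} {v : Node k} → v ∈ₙ decideSet X ⇔ X v
  ∈-decideSet {X = X} {v} with em {X v}
  ... | yes x = mk⇔ (λ _ → x) (λ _ → refl)
  ... | no ¬x = mk⇔ (λ ()) (⊥-elim ∘ ¬x)

state : Node k → Fin k
state (v₁ q _)   = q
state (v₂ q _ _) = q

¬IsV₁⇔IsV₂ : (v : Node k) → (¬ IsV₁ v) ⇔ IsV₂ v
¬IsV₁⇔IsV₂ (v₁ _ _)   = mk⇔ (λ ¬tt → ¬tt tt) λ ()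
¬IsV₁⇔IsV₂ (v₂ _ _ _) = mk⇔ _ λ _ ()

-- Plays alternate between V₁ and V₂ and the level grows after each V₂ node,
-- so a play can be at v only at index position v.
position : Node k → ℕ
position (v₁ _ n)   = n + n
position (v₂ _ _ n) = suc (n + n)

SameSlot : Node k → Node k → Set
SameSlot v w = level v ≡ level w × (IsV₁ v ⇔ IsV₁ w)

level≡⌊position/2⌋ : (v : Node k) → level v ≡ ⌊ position v /2⌋
level≡⌊position/2⌋ (v₁ _ n)   = n≡⌊n+n/2⌋ n
level≡⌊position/2⌋ (v₂ _ _ n) = n≡⌈n+n/2⌉ n

n+n≢1+m+m : ∀ n m → n + n ≢ suc (m + m)
n+n≢1+m+m n m eq = even≢odd n m (subst₂ (λ a b → n + a ≡ suc (m + b)) (sym (+-identityʳ n)) (sym (+-identityʳ m)) eq)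

samePosition⇒sameSlot : (v w : Node k) → position v ≡ position w → SameSlot v w
samePosition⇒sameSlot v w eq = level-eq , owner-eq v w eq
  where
  level-eq : level v ≡ level w
  level-eq = trans (level≡⌊position/2⌋ v) (trans (cong ⌊_/2⌋ eq) (sym (level≡⌊position/2⌋ w)))
  owner-eq : (v w : Node k) → position v ≡ position w → IsV₁ v ⇔ IsV₁ w
  owner-eq (v₁ _ _)   (v₁ _ _)   _  = ⇔-refl
  owner-eq (v₁ _ n)   (v₂ _ _ m) eq = ⊥-elim (n+n≢1+m+m n m eq)
  owner-eq (v₂ _ _ n) (v₁ _ m)   eq = ⊥-elim (n+n≢1+m+m m n (sym eq))
  owner-eq (v₂ _ _ _) (v₂ _ _ _) _  = ⇔-refl

sameSlot⇒samePosition : (v w : Node k) → SameSlot v w → position v ≡ position w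
sameSlot⇒samePosition (v₁ _ n)   (v₁ _ m)   (refl , _) = refl
sameSlot⇒samePosition (v₁ _ _)   (v₂ _ _ _) (_ , v₁⇔) = ⊥-elim (to v₁⇔ tt)
sameSlot⇒samePosition (v₂ _ _ _) (v₁ _ _)   (_ , v₁⇔) = ⊥-elim (from v₁⇔ tt)
sameSlot⇒samePosition (v₂ _ _ n) (v₂ _ _ m) (refl , _) = refl

level≤position : (v : Node k) → level v ≤ position v
level≤position v = subst (_≤ position v) (sym (level≡⌊position/2⌋ v)) (⌊n/2⌋≤n (position v))

level<level : (v w : Node k) → 2 + position v ≤ position w → level v < level w
level<level v w le = begin
  suc (level v)            ≡⟨ cong suc (level≡⌊position/2⌋ v) ⟩
  ⌊ 2 + position v /2⌋     ≤⟨ ⌊n/2⌋-mono le ⟩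
  ⌊ position w /2⌋         ≡⟨ sym (level≡⌊position/2⌋ w) ⟩
  level w                  ∎
  where open ≤-Reasoning

data Player : Set where
  I II : Player

LeastIsOdd : (ℕ → Set) → Set
LeastIsOdd F = Σ ℕ λ c → F c × (∀ c′ → c′ < c → ¬ F c′) × c % 2 ≡ 1

leastIsOdd-cong : {F G : ℕ → Set} → (∀ c → F c ⇔ G c) → LeastIsOdd F ⇔ LeastIsOdd G
leastIsOdd-cong F⇔G = mk⇔
  (λ (c , Fc , least , odd) → c , to (F⇔G c) Fc , (λ c′ c′<c → least c′ c′<c ∘ from (F⇔G c′)) , odd)
  (λ (c , Gc , least , odd) → c , from (F⇔G c) Gc , (λ c′ c′<c → least c′ c′<c ∘ to (F⇔G c′)) , odd)

module Game (A : DPA) (P : SubsetℕP) where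
  open DPA A

  Owns : Player → Node nQ → Set
  Owns I  = IsV₁
  Owns II = IsV₂

  -- Consistent I and Consistent II are ConsistentI and ConsistentII, definitionally.
  Consistent : Player → NodeSet nQ → Play A P → Set
  Consistent p U π = (π 0 ≡ initNode A P) ×
    (∀ i → Σ Bool λ b → Edge A P b (π i) (π (suc i)) × (Owns p (π i) → b ≡ U (π i)))

  Wins : Player → Play A P → Set
  Wins I  = WonByI A P
  Wins II = WonByII A P

  WinningStrategy : Player → NodeSet nQ → Set
  WinningStrategy p U = (∀ v → v ∈ₙ U → Owns p v) × (∀ π → Consistent p U π → Wins p π)

  position-step : (v : Node nQ) (b : Bool) → position (step A P v b) ≡ suc (position v)
  position-step (v₁ _ _)   b = refl
  position-step (v₂ _ _ n) b = cong suc (+-suc n n)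

  consistent⇒position : ∀ p U {π} → Consistent p U π → ∀ i → position (π i) ≡ i
  consistent⇒position p U (π₀≡init , _) zero = cong position π₀≡init
  consistent⇒position p U {π} c@(_ , moves) (suc i) with moves i
  ... | b , step≡ , _ = begin
    position (π (suc i))            ≡⟨ cong position (sym step≡) ⟩
    position (step A P (π i) b)     ≡⟨ position-step (π i) b ⟩
    suc (position (π i))            ≡⟨ cong suc (consistent⇒position p U c i) ⟩
    suc i                           ∎
    where open ≡-Reasoning

  record IsPlaySet (p : Player) (U Z : NodeSet nQ) : Set where
    field
      init∈       : initNode A P ∈ₙ Z
      move∈       : ∀ v → v ∈ₙ Z → Σ Bool λ b → step A P v b ∈ₙ Z × (Owns p v → b ≡ U v)
      slot-unique : ∀ v w → v ∈ₙ Z → w ∈ₙ Z → SameSlot v w → v ≡ w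

  InfOftenIn : NodeSet nQ → ℕ → Set
  InfOftenIn Z c = ∀ (x : Node nQ) → ∃ λ y → y ∈ₙ Z × level x < level y × colour A P y ≡ c

  WinsIn : Player → NodeSet nQ → Set
  WinsIn I  Z = LeastIsOdd (InfOftenIn Z)
  WinsIn II Z = ¬ LeastIsOdd (InfOftenIn Z)

  module _ {π : Play A P} {Z : NodeSet nQ} (position-π : ∀ i → position (π i) ≡ i)
           (range : ∀ v → v ∈ₙ Z ⇔ ∃ λ i → π i ≡ v) where

    infOften⇔infOftenIn : ∀ c → InfOften A P π c ⇔ InfOftenIn Z c
    infOften⇔infOftenIn c = mk⇔ to′ from′
      where
      to′ : InfOften A P π c → InfOftenIn Z c
      to′ often x with often (2 + position x)
      ... | j , j≥ , colour≡c = π j , from (range (π j)) (j , refl) ,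
            level<level x (π j) (subst (2 + position x ≤_) (sym (position-π j)) j≥) , colour≡c
      from′ : InfOftenIn Z c → InfOften A P π c
      from′ often i with often (v₁ qinit i)   -- any node of level i
      ... | y , y∈Z , i<level , colour≡c with to (range y) y∈Z
      ...   | j , refl = j , subst (i ≤_) (position-π j) (≤-trans (<⇒≤ i<level) (level≤position (π j))) , colour≡c

    wins⇔winsIn : ∀ p → Wins p π ⇔ WinsIn p Z
    wins⇔winsIn I  = leastIsOdd-cong infOften⇔infOftenIn
    wins⇔winsIn II = ¬-cong-⇔ (leastIsOdd-cong infOften⇔infOftenIn)

  playSet⇒play : ∀ {p U Z} → IsPlaySet p U Z →
                 Σ (Play A P) λ π → Consistent p U π × (∀ v → v ∈ₙ Z ⇔ ∃ λ i → π i ≡ v)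
  playSet⇒play {p} {U} {Z} S = proj₁ ∘ walk , consistent , range
    where
    open IsPlaySet S
    advance : Σ (Node nQ) (_∈ₙ Z) → Σ (Node nQ) (_∈ₙ Z)
    advance (v , v∈Z) = step A P v (proj₁ (move∈ v v∈Z)) , proj₁ (proj₂ (move∈ v v∈Z))
    walk : ℕ → Σ (Node nQ) (_∈ₙ Z)
    walk zero    = initNode A P , init∈
    walk (suc i) = advance (walk i)
    consistent : Consistent p U (proj₁ ∘ walk)
    consistent = refl , λ i → let (v , v∈Z) = walk i in proj₁ (move∈ v v∈Z) , refl , proj₂ (proj₂ (move∈ v v∈Z))
    range : ∀ v → v ∈ₙ Z ⇔ ∃ λ i → proj₁ (walk i) ≡ v
    range v = mk⇔
      (λ v∈Z → let i = position v in i ,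
         slot-unique _ v (proj₂ (walk i)) v∈Z (samePosition⇒sameSlot _ v (consistent⇒position p U consistent i)))
      (λ { (i , refl) → proj₂ (walk i) })

  module _ (em : ExcludedMiddle 0ℓ) where
    open Classical em

    rangeSet : Play A P → NodeSet nQ
    rangeSet π = decideSet λ v → ∃ λ i → π i ≡ v

    ∈-rangeSet : ∀ π v → v ∈ₙ rangeSet π ⇔ ∃ λ i → π i ≡ v
    ∈-rangeSet π v = ∈-decideSet {X = λ v → ∃ λ i → π i ≡ v}

    consistent⇒rangeIsPlaySet : ∀ {p U π} → Consistent p U π → IsPlaySet p U (rangeSet π)
    consistent⇒rangeIsPlaySet {p} {U} {π} c@(π₀≡init , moves) = record
      { init∈       = from (∈-rangeSet π _) (0 , π₀≡init)
      ; move∈       = move∈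
      ; slot-unique = slot-unique
      }
      where
      move∈ : ∀ v → v ∈ₙ rangeSet π → Σ Bool λ b → step A P v b ∈ₙ rangeSet π × (Owns p v → b ≡ U v)
      move∈ v v∈ with to (∈-rangeSet π v) v∈
      ... | i , refl = let (b , e , own) = moves i in b , from (∈-rangeSet π _) (suc i , sym e) , own
      slot-unique : ∀ v w → v ∈ₙ rangeSet π → w ∈ₙ rangeSet π → SameSlot v w → v ≡ w
      slot-unique v w v∈ w∈ same with to (∈-rangeSet π v) v∈ | to (∈-rangeSet π w) w∈
      ... | i , refl | j , refl = cong π (begin
        i                ≡⟨ sym (consistent⇒position p U c i) ⟩
        position (π i)   ≡⟨ sameSlot⇒samePosition (π i) (π j) same ⟩
        position (π j)   ≡⟨ consistent⇒position p U c j ⟩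
        j                ∎)
        where open ≡-Reasoning

    winningStrategy⇔winsOnPlaySets : ∀ p U →
      WinningStrategy p U ⇔ ((∀ v → v ∈ₙ U → Owns p v) × (∀ Z → IsPlaySet p U Z → WinsIn p Z))
    winningStrategy⇔winsOnPlaySets p U = mk⇔
      (λ (U⊆Vₚ , wins) → U⊆Vₚ , λ Z S →
        let (π , c , range) = playSet⇒play S in to (wins⇔winsIn (consistent⇒position p U c) range p) (wins π c))
      (λ (U⊆Vₚ , winsIn) → U⊆Vₚ , λ π c →
        from (wins⇔winsIn (consistent⇒position p U c) (∈-rangeSet π) p) (winsIn _ (consistent⇒rangeIsPlaySet c)))

infixr 6 _∧ᶠ_
infixr 5 _∨ᶠ_
infixr 4 _⇒ᶠ_

_∧ᶠ_ : Formula k fo so → Formula k fo so → Formula k fo so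
_∧ᶠ_ = And

_∨ᶠ_ : Formula k fo so → Formula k fo so → Formula k fo so
φ ∨ᶠ ψ = Not (Not φ ∧ᶠ Not ψ)

_⇒ᶠ_ : Formula k fo so → Formula k fo so → Formula k fo so
φ ⇒ᶠ ψ = Not (φ ∧ᶠ Not ψ)

∀¹ : Formula k (suc fo) so → Formula k fo so
∀¹ φ = Not (Ex₁ (Not φ))

∀² : Formula k fo (suc so) → Formula k fo so
∀² φ = Not (Ex₂ (Not φ))

⊥ᶠ : Formula k fo so
⊥ᶠ = Ex₁ (Not (Eq (# 0) (# 0)))

⊤ᶠ : Formula k fo so
⊤ᶠ = Not ⊥ᶠ

⋁ : (Fin n → Formula k fo so) → Formula k fo so
⋁ {n = zero}  φ = ⊥ᶠ
⋁ {n = suc n} φ = φ Fin.zero ∨ᶠ ⋁ (φ ∘ Fin.suc)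

when : {X : Set} → Dec X → Formula k fo so → Formula k fo so
when (yes _) φ = φ
when (no _)  φ = ⊥ᶠ

InV₁ : Fin fo → Formula k fo so
InV₁ x = ⋁ λ q → Rel (inj₁ q) x

HasState : Fin k → Fin fo → Formula k fo so
HasState q x = Rel (inj₁ q) x ∨ᶠ Rel (inj₂ (q , false)) x ∨ᶠ Rel (inj₂ (q , true)) x

HasColour : (Fin k → ℕ) → ℕ → Fin fo → Formula k fo so
HasColour col c x = ⋁ λ q → when (col q ≟ c) (HasState q x)

OwnedBy : Player → Fin fo → Formula k fo so
OwnedBy I  x = InV₁ x
OwnedBy II x = Not (InV₁ x)

MemberIs : Bool → Fin fo → Fin so → Formula k fo so
MemberIs true  x X = Mem x X
MemberIs false x X = Not (Mem x X)

SameSlotF : Fin fo → Fin fo → Formula k fo so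
SameSlotF x y = Not (Prec x y) ∧ᶠ Not (Prec y x) ∧ᶠ (InV₁ x ⇒ᶠ InV₁ y) ∧ᶠ (InV₁ y ⇒ᶠ InV₁ x)

-- Second-order variables: # 0 is the candidate node set Y, # 1 the strategy set X.
-- In MoveF the first-order variable # 1 moves to # 0.
MoveF : Player → Bool → Formula k 2 2
MoveF p b = E b (# 1) (# 0) ∧ᶠ (OwnedBy p (# 1) ⇒ᶠ MemberIs b (# 1) (# 1))

PlaySetF : Player → Formula k 0 2
PlaySetF p =
     Ex₁ (Init (# 0) ∧ᶠ Mem (# 0) (# 0))
  ∧ᶠ ∀¹ (Mem (# 0) (# 0) ⇒ᶠ Ex₁ (Mem (# 0) (# 0) ∧ᶠ (MoveF p false ∨ᶠ MoveF p true)))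
  ∧ᶠ ∀¹ (∀¹ (Mem (# 1) (# 0) ∧ᶠ Mem (# 0) (# 0) ∧ᶠ SameSlotF (# 1) (# 0) ⇒ᶠ Eq (# 1) (# 0)))

module _ (col : Fin k → ℕ) where

  InfOftenF : ℕ → Fin so → Formula k fo so
  InfOftenF c Y = ∀¹ (Ex₁ (Mem (# 0) Y ∧ᶠ Prec (# 1) (# 0) ∧ᶠ HasColour col c (# 0)))

  NoneInfOftenBelowF : ℕ → Fin so → Formula k fo so
  NoneInfOftenBelowF zero    Y = ⊤ᶠ
  NoneInfOftenBelowF (suc c) Y = Not (InfOftenF c Y) ∧ᶠ NoneInfOftenBelowF c Y

  -- The least colour occurring infinitely often is the colour of some state.
  ParityF : Fin so → Formula k fo so
  ParityF Y = ⋁ λ q → when (col q % 2 ≟ 1) (InfOftenF (col q) Y ∧ᶠ NoneInfOftenBelowF (col q) Y)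

  WinsF : Player → Fin so → Formula k fo so
  WinsF I  Y = ParityF Y
  WinsF II Y = Not (ParityF Y)

winSt : Player → (A : DPA) → Formula (DPA.nQ A) 0 1
winSt p A = ∀¹ (Mem (# 0) (# 0) ⇒ᶠ OwnedBy p (# 0)) ∧ᶠ ∀² (PlaySetF p ⇒ᶠ WinsF (DPA.col A) p (# 0))

module Semantics (em : ExcludedMiddle 0ℓ) (A : DPA) (P : SubsetℕP) where
  open DPA A
  open Classical em
  open Game A P

  private
    variable
      ρ : Fin fo → Node nQ
      σ : Fin so → NodeSet nQ

  -- What Sat ρ σ ⊥ᶠ unfolds to; ρ and σ do not occur in it, so they are left out.
  ⊥ᶠ-unsat : ¬ ∃ λ (v : Node nQ) → ¬ v ≡ v
  ⊥ᶠ-unsat (_ , v≢v) = v≢v refl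

  sat-⋁ : (φ : Fin n → Formula nQ fo so) → Sat A P ρ σ (⋁ φ) ⇔ ∃ λ i → Sat A P ρ σ (φ i)
  sat-⋁ {n = zero}  φ = mk⇔ (⊥-elim ∘ ⊥ᶠ-unsat) λ ()
  sat-⋁ {n = suc n} {ρ = ρ} {σ = σ} φ = mk⇔ to′ from′
    where
    to′ : Sat A P ρ σ (⋁ φ) → ∃ λ i → Sat A P ρ σ (φ i)
    to′ h with to ¬[¬×¬]⇔⊎ h
    ... | inj₁ here  = Fin.zero , here
    ... | inj₂ there = let (i , s) = to (sat-⋁ (φ ∘ Fin.suc)) there in Fin.suc i , s
    from′ : (∃ λ i → Sat A P ρ σ (φ i)) → Sat A P ρ σ (⋁ φ)
    from′ (Fin.zero  , s) = from ¬[¬×¬]⇔⊎ (inj₁ s)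
    from′ (Fin.suc i , s) = from ¬[¬×¬]⇔⊎ (inj₂ (from (sat-⋁ (φ ∘ Fin.suc)) (i , s)))

  sat-when : {X : Set} (d : Dec X) (φ : Formula nQ fo so) → Sat A P ρ σ (when d φ) ⇔ (X × Sat A P ρ σ φ)
  sat-when (yes x) φ = mk⇔ (x ,_) proj₂
  sat-when (no ¬x) φ = mk⇔ (⊥-elim ∘ ⊥ᶠ-unsat) (⊥-elim ∘ ¬x ∘ proj₁)

  relInterp-V₁ : (v : Node nQ) → (∃ λ q → relInterp A P (inj₁ q) v) ⇔ IsV₁ v
  relInterp-V₁ (v₁ q _)   = mk⇔ _ λ _ → q , refl
  relInterp-V₁ (v₂ _ _ _) = mk⇔ (λ ()) λ ()

  relInterp-state : (q : Fin nQ) (v : Node nQ) →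
    (relInterp A P (inj₁ q) v ⊎ relInterp A P (inj₂ (q , false)) v ⊎ relInterp A P (inj₂ (q , true)) v)
    ⇔ state v ≡ q
  relInterp-state q v = mk⇔ (to′ v) (from′ v)
    where
    to′ : ∀ v → relInterp A P (inj₁ q) v ⊎ relInterp A P (inj₂ (q , false)) v ⊎ relInterp A P (inj₂ (q , true)) v
        → state v ≡ q
    to′ (v₁ _ _)   (inj₁ q≡)              = sym q≡
    to′ (v₁ _ _)   (inj₂ (inj₁ ()))
    to′ (v₁ _ _)   (inj₂ (inj₂ ()))
    to′ (v₂ _ _ _) (inj₂ (inj₁ (q≡ , _))) = sym q≡
    to′ (v₂ _ _ _) (inj₂ (inj₂ (q≡ , _))) = sym q≡
    from′ : ∀ v → state v ≡ q
          → relInterp A P (inj₁ q) v ⊎ relInterp A P (inj₂ (q , false)) v ⊎ relInterp A P (inj₂ (q , true)) v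
    from′ (v₁ _ _)       refl = inj₁ refl
    from′ (v₂ _ false _) refl = inj₂ (inj₁ (refl , refl))
    from′ (v₂ _ true _)  refl = inj₂ (inj₂ (refl , refl))

  colour≡col∘state : (v : Node nQ) → colour A P v ≡ col (state v)
  colour≡col∘state (v₁ _ _)   = refl
  colour≡col∘state (v₂ _ _ _) = refl

  sat-InV₁ : (x : Fin fo) → Sat A P ρ σ (InV₁ x) ⇔ IsV₁ (ρ x)
  sat-InV₁ {ρ = ρ} x = ⇔-trans (sat-⋁ _) (relInterp-V₁ (ρ x))

  sat-HasState : (q : Fin nQ) (x : Fin fo) → Sat A P ρ σ (HasState q x) ⇔ state (ρ x) ≡ q
  sat-HasState {ρ = ρ} q x = ⇔-trans ¬[¬×¬]⇔⊎ (⇔-trans (⇔-refl ⊎-⇔ ¬[¬×¬]⇔⊎) (relInterp-state q (ρ x)))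

  sat-HasColour : (c : ℕ) (x : Fin fo) → Sat A P ρ σ (HasColour col c x) ⇔ colour A P (ρ x) ≡ c
  sat-HasColour {ρ = ρ} {σ = σ} c x = mk⇔ to′ from′
    where
    to′ : Sat A P ρ σ (HasColour col c x) → colour A P (ρ x) ≡ c
    to′ h with to (sat-⋁ _) h
    ... | q , s with to (sat-when (col q ≟ c) _) s
    ...   | colq≡c , hasState = trans (colour≡col∘state (ρ x))
                                      (trans (cong col (to (sat-HasState {ρ = ρ} {σ = σ} q x) hasState)) colq≡c)
    from′ : colour A P (ρ x) ≡ c → Sat A P ρ σ (HasColour col c x)
    from′ colour≡c = from (sat-⋁ _) (state (ρ x) ,
      from (sat-when (col (state (ρ x)) ≟ c) _)
           (trans (sym (colour≡col∘state (ρ x))) colour≡c , from (sat-HasState {ρ = ρ} {σ = σ} _ x) refl))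

  sat-OwnedBy : (p : Player) (x : Fin fo) → Sat A P ρ σ (OwnedBy p x) ⇔ Owns p (ρ x)
  sat-OwnedBy I  x = sat-InV₁ x
  sat-OwnedBy {ρ = ρ} II x = ⇔-trans (¬-cong-⇔ (sat-InV₁ x)) (¬IsV₁⇔IsV₂ (ρ x))

  sat-MemberIs : (b : Bool) (x : Fin fo) (X : Fin so) → Sat A P ρ σ (MemberIs b x X) ⇔ b ≡ σ X (ρ x)
  sat-MemberIs true  x X = mk⇔ sym sym
  sat-MemberIs {ρ = ρ} {σ = σ} false x X with σ X (ρ x)
  ... | true  = mk⇔ (λ ¬refl → ⊥-elim (¬refl refl)) λ ()
  ... | false = mk⇔ (λ _ → refl) λ _ ()

  sat-InfOftenF : (c : ℕ) (Y : Fin so) → Sat A P ρ σ (InfOftenF col c Y) ⇔ InfOftenIn (σ Y) c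
  sat-InfOftenF c Y = ⇔-trans ¬∃¬⇔∀ (∀-cong-⇔ λ x → ∃-cong-⇔ λ y → ⇔-refl ×-⇔ ⇔-refl ×-⇔ sat-HasColour c (# 0))

  sat-NoneInfOftenBelowF : (c : ℕ) (Y : Fin so) →
    Sat A P ρ σ (NoneInfOftenBelowF col c Y) ⇔ (∀ c′ → c′ < c → ¬ InfOftenIn (σ Y) c′)
  sat-NoneInfOftenBelowF zero    Y = mk⇔ (λ _ _ ()) (λ _ → ⊥ᶠ-unsat)
  sat-NoneInfOftenBelowF {ρ = ρ} {σ = σ} (suc c) Y = mk⇔ to′ from′
    where
    to′ : Sat A P ρ σ (NoneInfOftenBelowF col (suc c) Y) → ∀ c′ → c′ < suc c → ¬ InfOftenIn (σ Y) c′
    to′ (¬often , below) c′ c′<1+c with m<1+n⇒m<n∨m≡n c′<1+c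
    ... | inj₁ c′<c = to (sat-NoneInfOftenBelowF c Y) below c′ c′<c
    ... | inj₂ refl = ¬often ∘ from (sat-InfOftenF c Y)
    from′ : (∀ c′ → c′ < suc c → ¬ InfOftenIn (σ Y) c′) → Sat A P ρ σ (NoneInfOftenBelowF col (suc c) Y)
    from′ none = none c ≤-refl ∘ to (sat-InfOftenF c Y) ,
                 from (sat-NoneInfOftenBelowF c Y) (λ c′ c′<c → none c′ (m≤n⇒m≤1+n c′<c))

  sat-ParityF : (Y : Fin so) → Sat A P ρ σ (ParityF col Y) ⇔ LeastIsOdd (InfOftenIn (σ Y))
  sat-ParityF {ρ = ρ} {σ = σ} Y = mk⇔ to′ from′
    where
    to′ : Sat A P ρ σ (ParityF col Y) → LeastIsOdd (InfOftenIn (σ Y))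
    to′ h with to (sat-⋁ _) h
    ... | q , s with to (sat-when (col q % 2 ≟ 1) _) s
    ...   | odd , often , below = col q , to (sat-InfOftenF _ Y) often , to (sat-NoneInfOftenBelowF _ Y) below , odd
    from′ : LeastIsOdd (InfOftenIn (σ Y)) → Sat A P ρ σ (ParityF col Y)
    from′ (c , often , least , odd) with often (initNode A P)
    ... | y , _ , _ , colour≡c with trans (sym (colour≡col∘state y)) colour≡c
    ...   | refl = from (sat-⋁ _) (state y , from (sat-when (col (state y) % 2 ≟ 1) _)
                     (odd , from (sat-InfOftenF _ Y) often , from (sat-NoneInfOftenBelowF _ Y) least))

  sat-WinsF : (p : Player) (Y : Fin so) → Sat A P ρ σ (WinsF col p Y) ⇔ WinsIn p (σ Y)
  sat-WinsF I  Y = sat-ParityF Y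
  sat-WinsF II Y = ¬-cong-⇔ (sat-ParityF Y)

  sat-SameSlotF : (x y : Fin fo) → Sat A P ρ σ (SameSlotF x y) ⇔ SameSlot (ρ x) (ρ y)
  sat-SameSlotF {ρ = ρ} {σ = σ} x y = mk⇔
    (λ (x≮y , y≮x , x→y , y→x) →
       ≤-antisym (≮⇒≥ y≮x) (≮⇒≥ x≮y) , mk⇔ (V₁-transfer x y (to ¬[×¬]⇔→ x→y)) (V₁-transfer y x (to ¬[×¬]⇔→ y→x)))
    (λ (level≡ , V₁⇔) →
       <-irrefl level≡ , <-irrefl (sym level≡) ,
       from ¬[×¬]⇔→ (V₁-reflect x y (to V₁⇔)) , from ¬[×¬]⇔→ (V₁-reflect y x (from V₁⇔)))
    where
    V₁-transfer : ∀ x y → (Sat A P ρ σ (InV₁ x) → Sat A P ρ σ (InV₁ y)) → IsV₁ (ρ x) → IsV₁ (ρ y)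
    V₁-transfer x y f = to (sat-InV₁ y) ∘ f ∘ from (sat-InV₁ x)
    V₁-reflect : ∀ x y → (IsV₁ (ρ x) → IsV₁ (ρ y)) → Sat A P ρ σ (InV₁ x) → Sat A P ρ σ (InV₁ y)
    V₁-reflect x y f = from (sat-InV₁ y) ∘ f ∘ to (sat-InV₁ x)

  sat-MoveF : (p : Player) (b : Bool) {ρ : Fin 2 → Node nQ} {σ : Fin 2 → NodeSet nQ} →
    Sat A P ρ σ (MoveF p b) ⇔ (step A P (ρ (# 1)) b ≡ ρ (# 0) × (Owns p (ρ (# 1)) → b ≡ σ (# 1) (ρ (# 1))))
  sat-MoveF p b = ⇔-refl ×-⇔ ⇔-trans ¬[×¬]⇔→ (→-cong-⇔ (sat-OwnedBy p (# 1)) (sat-MemberIs b (# 1) (# 1)))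

  sat-PlaySetF : (p : Player) {ρ : Fin 0 → Node nQ} {σ : Fin 2 → NodeSet nQ} →
    Sat A P ρ σ (PlaySetF p) ⇔ IsPlaySet p (σ (# 1)) (σ (# 0))
  sat-PlaySetF p {ρ} {σ} = mk⇔
    (λ (i , m , s) → record { init∈ = to init⇔ i ; move∈ = to move⇔ m ; slot-unique = to slot⇔ s })
    (λ S → let open IsPlaySet S in from init⇔ init∈ , from move⇔ move∈ , from slot⇔ slot-unique)
    where
    U Z : NodeSet nQ
    U = σ (# 1)
    Z = σ (# 0)
    init⇔ : Sat A P ρ σ (Ex₁ (Init (# 0) ∧ᶠ Mem (# 0) (# 0))) ⇔ initNode A P ∈ₙ Z
    init⇔ = mk⇔ (λ { (_ , refl , init∈) → init∈ }) (λ init∈ → initNode A P , refl , init∈)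
    move⇔ : Sat A P ρ σ (∀¹ (Mem (# 0) (# 0) ⇒ᶠ Ex₁ (Mem (# 0) (# 0) ∧ᶠ (MoveF p false ∨ᶠ MoveF p true))))
          ⇔ (∀ v → v ∈ₙ Z → Σ Bool λ b → step A P v b ∈ₙ Z × (Owns p v → b ≡ U v))
    move⇔ = ⇔-trans ¬∃¬⇔∀ (∀-cong-⇔ λ v → ⇔-trans ¬[×¬]⇔→ (→-cong-⇔ ⇔-refl
              (⇔-trans (∃-cong-⇔ λ w → ⇔-refl ×-⇔ ⇔-trans ¬[¬×¬]⇔⊎ (sat-MoveF p false ⊎-⇔ sat-MoveF p true))
                       (∃-target⇔∃-label (step A P v)))))
    slot⇔ : Sat A P ρ σ (∀¹ (∀¹ (Mem (# 1) (# 0) ∧ᶠ Mem (# 0) (# 0) ∧ᶠ SameSlotF (# 1) (# 0) ⇒ᶠ Eq (# 1) (# 0))))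
          ⇔ (∀ v w → v ∈ₙ Z → w ∈ₙ Z → SameSlot v w → v ≡ w)
    slot⇔ = ⇔-trans ¬∃¬⇔∀ (∀-cong-⇔ λ v → ⇔-trans ¬∃¬⇔∀ (∀-cong-⇔ λ w →
              ⇔-trans ¬[×¬]⇔→ (⇔-trans (→-cong-⇔ (⇔-refl ×-⇔ ⇔-refl ×-⇔ sat-SameSlotF (# 1) (# 0)) ⇔-refl)
                (mk⇔ (λ f v∈ w∈ same → f (v∈ , w∈ , same)) (λ f (v∈ , w∈ , same) → f v∈ w∈ same)))))

  sat-winSt : (p : Player) {ρ : Fin 0 → Node nQ} {σ : Fin 1 → NodeSet nQ} →
    Sat A P ρ σ (winSt p A)
    ⇔ ((∀ v → v ∈ₙ σ (# 0) → Owns p v) × (∀ Z → IsPlaySet p (σ (# 0)) Z → WinsIn p Z))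
  sat-winSt p =
        ⇔-trans ¬∃¬⇔∀ (∀-cong-⇔ λ v → ⇔-trans ¬[×¬]⇔→ (→-cong-⇔ ⇔-refl (sat-OwnedBy p (# 0))))
    ×-⇔ ⇔-trans ¬∃¬⇔∀ (∀-cong-⇔ λ Z → ⇔-trans ¬[×¬]⇔→ (→-cong-⇔ (sat-PlaySetF p) (sat-WinsF p (# 0))))

lemma6p4 : Σ ((A : DPA) → Formula (DPA.nQ A) 0 1) λ winStI →
           Σ ((A : DPA) → Formula (DPA.nQ A) 0 1) λ winStII →
           ExcludedMiddle 0ℓ →
           (A : DPA) → (P : SubsetℕP) → (U : NodeSet (DPA.nQ A)) →
           (Models₁ A P (winStI A) U ⇔ WinStratI A P U)
           × (Models₁ A P (winStII A) U ⇔ WinStratII A P U)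
lemma6p4 = winSt I , winSt II , λ em A P U →
  let open Semantics em A P
      open Game A P
      correct : ∀ p → Models₁ A P (winSt p A) U ⇔ WinningStrategy p U
      correct p = ⇔-trans (sat-winSt p) (⇔-sym (winningStrategy⇔winsOnPlaySets em p U))
  in correct I , correct II
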